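{- For every integer $n\ge2$ and all integers $m_{1}, \dots, m_{n} \geq 0$, \[ (m_{1},m_{2}, \dots, m_{n-1};m_{n})_{1} =(m_{1};m_{2} +\cdots + m_{n})_{1}\cdots(m_{n-2};m_{n-1}+m_{n})_{1}(m_{n-1};m_{n})_{1}. \]
   Context: Tableaux of the first kind: a shape is a sequence of columns $1,\dots,n$ from left to right with heights $m_1,\dots,m_n\ge0$. A tableau of this shape fills each position with a nonnegative integer such that (i) entries strictly increase going down each column, and (ii) an entry lying in column $i$ and having $k$ entries above it in that column is at most $k+(m_{i+1}+\cdots+m_n)$. Define $(m_1,\dots,m_{n-1};m_n)_1=\sum_{T}\prod_{e}(-e)$, where $T$ runs over all tableaux of shape $(m_1,\dots,m_n)$ and the product runs over the entries $e$ of $T$ lying in columns $1,\dots,n-1$ (empty product $=1$). In particular $(a;b)_1$ is this quantity for the two-column shape $(a,b)$. (Equivalently, $(m_1,\dots,m_{n-1};m_n)_1$ is obtained from the tableau polynomial $\sum_T\prod_e(x_{i(e)}-e)$ by dividing out the common factor $\prod_{k=0}^{m_n-1}(x_n-k)$ contributed by the last column and setting all variables to $0$.) -}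

module Defs where

open import Data.Nat using (ℕ; zero; suc; _+_; _<ᵇ_; _≤ᵇ_; _≡ᵇ_)
open import Data.Bool using (Bool; true; false; _∧_)
open import Data.List using (List; []; _∷_; map; concatMap; filterᵇ; foldr; upTo; length)
open import Data.Integer as ℤ using (ℤ; +_; -_)
open import Data.Nat.ListAction using (sum)

-- A shape is a list of column heights (m₁ , … , mₙ), left to right.
-- A filling of a shape is a list of columns, each column a list of entries read top to bottom.

boundedLists : ℕ → ℕ → List (List ℕ)
boundedLists N zero = [] ∷ []
boundedLists N (suc m) = concatMap (λ e → map (e ∷_) (boundedLists N m)) (upTo (suc N))

boundedFillings : ℕ → List ℕ → List (List (List ℕ))
boundedFillings N [] = [] ∷ []
boundedFillings N (m ∷ ms) = concatMap (λ c → map (c ∷_) (boundedFillings N ms)) (boundedLists N m)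

strictlyIncreasing : List ℕ → Bool
strictlyIncreasing [] = true
strictlyIncreasing (x ∷ []) = true
strictlyIncreasing (x ∷ y ∷ r) = (x <ᵇ y) ∧ strictlyIncreasing (y ∷ r)

boundedFrom : ℕ → ℕ → List ℕ → Bool
boundedFrom R k [] = true
boundedFrom R k (e ∷ es) = (e ≤ᵇ k + R) ∧ boundedFrom R (suc k) es

columnOK : ℕ → List ℕ → Bool
columnOK R c = strictlyIncreasing c ∧ boundedFrom R 0 c

isTableau : List ℕ → List (List ℕ) → Bool
isTableau [] [] = true
isTableau (m ∷ ms) (c ∷ cs) = (length c ≡ᵇ m) ∧ (columnOK (sum ms) c ∧ isTableau ms cs)
isTableau _ _ = false

-- All tableaux of a shape.  Every entry of a tableau is ≤ (m_i - 1) + (m_{i+1}+⋯+m_n)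
-- ≤ m₁+⋯+mₙ by (ii), so enumerating fillings with entries ≤ sum of heights loses nothing.
tableaux : List ℕ → List (List (List ℕ))
tableaux ms = filterᵇ (isTableau ms) (boundedFillings (sum ms) ms)

sumℤ : List ℤ → ℤ
sumℤ = foldr ℤ._+_ (+ 0)

prodℤ : List ℤ → ℤ
prodℤ = foldr ℤ._*_ (+ 1)

weight : List (List ℕ) → ℤ
weight [] = + 1
weight (c ∷ []) = + 1
weight (c ∷ c' ∷ cs) = prodℤ (map (λ e → - (+ e)) c) ℤ.* weight (c' ∷ cs)

bracket : List ℕ → ℤ
bracket ms = sumℤ (map weight (tableaux ms))

rhsProduct : List ℕ → ℤ
rhsProduct [] = + 1
rhsProduct (a ∷ []) = + 1
rhsProduct (a ∷ b ∷ r) = bracket (a ∷ sum (b ∷ r) ∷ []) ℤ.* rhsProduct (b ∷ r)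

-- Expanding a filling column by column, both the tableau condition and the weight factor over
-- the columns, the condition on column i depending only on mᵢ and R = m_{i+1}+⋯+mₙ.  So the
-- tableau sum is the product of column sums C(mᵢ, R), the last column contributing 1: with R = 0
-- its only admissible filling is 0, 1, …, mₙ − 1.  The same factorisation for the two-column
-- shape (mᵢ, R) identifies C(mᵢ, R) with (mᵢ; R)₁.  The only care needed concerns the bound N on
-- the enumerated entries, which differs between the shapes: a column sum does not depend on N
-- once N ≥ mᵢ + R, since admissible entries stay below mᵢ + R.
module Submission where

open import Defs
open import Data.Nat using (ℕ; zero; suc; _+_; _≤_; _<_; _≤ᵇ_; _≡ᵇ_; s≤s; _≤′_; ≤′-refl; ≤′-step)
open import Data.Nat.Properties as ℕ
  using (+-suc; m≤m+n; m≤n+m; ≤-trans; ≤-refl; <⇒≱; <⇒≢; >⇒≢; ≤⇒≤′;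
         ≤ᵇ⇒≤; ≤⇒≤ᵇ; ≡ᵇ⇒≡; ≡⇒≡ᵇ; <-cmp; m≤n⇒m≤1+n; m<1+n⇒m<n∨m≡n)
open import Data.Nat.ListAction using (sum)
open import Data.Integer as ℤ using (ℤ; +_; -_)
open import Data.Integer.Properties as ℤ
  using (+-identityˡ; +-identityʳ; +-assoc; *-zeroˡ; *-zeroʳ; *-identityʳ; *-distribˡ-+; *-distribʳ-+)
open import Data.Bool using (Bool; true; false; _∧_; if_then_else_; T)
open import Data.Bool.Properties using (∧-assoc; ∧-zeroʳ; ∧-identityʳ; T-≡; T-∧)
open import Data.List using (List; []; _∷_; length; map; concatMap; filterᵇ; upTo; _++_; [_])
open import Data.List.Properties using (upTo-∷ʳ)
open import Data.List.Relation.Unary.All as All using (All; []; _∷_)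
open import Data.List.Relation.Unary.All.Properties using (All¬⇒¬Any; all-upTo)
open import Data.List.Relation.Unary.Any as Any using (Any; here; there)
open import Data.Product using (_,_; proj₂)
open import Data.Sum using (inj₁; inj₂)
open import Data.Empty using (⊥-elim)
open import Function using (Equivalence; _∘_)
open import Relation.Nullary using (¬_)
open import Relation.Binary.Definitions using (tri<; tri≈; tri>)
open import Relation.Binary.PropositionalEquality using (_≡_; _≢_; refl; sym; trans; cong; cong₂; subst)
open Relation.Binary.PropositionalEquality.≡-Reasoning

open Equivalence using (to)

T⇒≡true : ∀ {b} → T b → b ≡ true
T⇒≡true = to T-≡

¬T⇒≡false : ∀ {b} → ¬ T b → b ≡ false
¬T⇒≡false {true} ¬t = ⊥-elim (¬t _)
¬T⇒≡false {false} _ = refl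

∑ : {A : Set} → List A → (A → ℤ) → ℤ
∑ xs f = sumℤ (map f xs)

module _ {A : Set} where

  ∑-cong : (xs : List A) {f g : A → ℤ} → (∀ x → f x ≡ g x) → ∑ xs f ≡ ∑ xs g
  ∑-cong [] _ = refl
  ∑-cong (x ∷ xs) f≗g = cong₂ ℤ._+_ (f≗g x) (∑-cong xs f≗g)

  ∑-zero : (xs : List A) {f : A → ℤ} → All (λ x → f x ≡ + 0) xs → ∑ xs f ≡ + 0
  ∑-zero [] [] = refl
  ∑-zero (x ∷ xs) (fx≡0 ∷ f≡0) = trans (cong₂ ℤ._+_ fx≡0 (∑-zero xs f≡0)) (+-identityʳ (+ 0))

  ∑-++ : (xs ys : List A) (f : A → ℤ) → ∑ (xs ++ ys) f ≡ ∑ xs f ℤ.+ ∑ ys f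
  ∑-++ [] ys f = sym (+-identityˡ _)
  ∑-++ (x ∷ xs) ys f = trans (cong (λ z → f x ℤ.+ z) (∑-++ xs ys f)) (sym (+-assoc (f x) _ _))

  ∑-*ˡ : (xs : List A) (a : ℤ) (f : A → ℤ) → ∑ xs (λ x → a ℤ.* f x) ≡ a ℤ.* ∑ xs f
  ∑-*ˡ [] a f = sym (*-zeroʳ a)
  ∑-*ˡ (x ∷ xs) a f = trans (cong (λ z → a ℤ.* f x ℤ.+ z) (∑-*ˡ xs a f)) (sym (*-distribˡ-+ a (f x) _))

  ∑-*ʳ : (xs : List A) (a : ℤ) (f : A → ℤ) → ∑ xs (λ x → f x ℤ.* a) ≡ ∑ xs f ℤ.* a
  ∑-*ʳ [] a f = sym (*-zeroˡ a)
  ∑-*ʳ (x ∷ xs) a f = trans (cong (λ z → f x ℤ.* a ℤ.+ z) (∑-*ʳ xs a f)) (sym (*-distribʳ-+ a (f x) _))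

  ∑-filterᵇ : (p : A → Bool) (f : A → ℤ) (xs : List A) →
              ∑ (filterᵇ p xs) f ≡ ∑ xs (λ x → if p x then f x else + 0)
  ∑-filterᵇ p f [] = refl
  ∑-filterᵇ p f (x ∷ xs) with p x
  ... | true  = cong (λ z → f x ℤ.+ z) (∑-filterᵇ p f xs)
  ... | false = trans (∑-filterᵇ p f xs) (sym (+-identityˡ _))

∑-map : {A B : Set} (h : A → B) (xs : List A) (f : B → ℤ) → ∑ (map h xs) f ≡ ∑ xs (λ x → f (h x))
∑-map h [] f = refl
∑-map h (x ∷ xs) f = cong (λ z → f (h x) ℤ.+ z) (∑-map h xs f)

∑-concatMap : {A B : Set} (h : A → List B) (xs : List A) (f : B → ℤ) →
              ∑ (concatMap h xs) f ≡ ∑ xs (λ x → ∑ (h x) f)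
∑-concatMap h [] f = refl
∑-concatMap h (x ∷ xs) f =
  trans (∑-++ (h x) (concatMap h xs) f) (cong (λ z → ∑ (h x) f ℤ.+ z) (∑-concatMap h xs f))

∑-upTo-suc : (n : ℕ) (f : ℕ → ℤ) → ∑ (upTo (suc n)) f ≡ ∑ (upTo n) f ℤ.+ f n
∑-upTo-suc n f = begin
  ∑ (upTo (suc n)) f                      ≡⟨ cong (λ xs → ∑ xs f) (sym (upTo-∷ʳ n)) ⟩
  ∑ (upTo n ++ [ n ]) f                   ≡⟨ ∑-++ (upTo n) [ n ] f ⟩
  ∑ (upTo n) f ℤ.+ (f n ℤ.+ + 0)          ≡⟨ cong (λ z → ∑ (upTo n) f ℤ.+ z) (+-identityʳ (f n)) ⟩
  ∑ (upTo n) f ℤ.+ f n                    ∎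

∑-upTo-single : (n k : ℕ) (f : ℕ → ℤ) → k < n → (∀ e → e ≢ k → f e ≡ + 0) → ∑ (upTo n) f ≡ f k
∑-upTo-single (suc n) k f k<1+n vanish with m<1+n⇒m<n∨m≡n k<1+n
... | inj₁ k<n = begin
  ∑ (upTo (suc n)) f          ≡⟨ ∑-upTo-suc n f ⟩
  ∑ (upTo n) f ℤ.+ f n        ≡⟨ cong₂ ℤ._+_ (∑-upTo-single n k f k<n vanish) (vanish n (>⇒≢ k<n)) ⟩
  f k ℤ.+ + 0                 ≡⟨ +-identityʳ (f k) ⟩
  f k                         ∎
... | inj₂ refl = begin
  ∑ (upTo (suc n)) f          ≡⟨ ∑-upTo-suc n f ⟩
  ∑ (upTo n) f ℤ.+ f n        ≡⟨ cong (ℤ._+ f n) (∑-zero (upTo n) (All.map (λ e<n → vanish _ (<⇒≢ e<n)) (all-upTo n))) ⟩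
  + 0 ℤ.+ f n                 ≡⟨ +-identityˡ (f n) ⟩
  f n                         ∎

∑-boundedLists-suc : (N m : ℕ) (f : List ℕ → ℤ) →
  ∑ (boundedLists N (suc m)) f ≡ ∑ (upTo (suc N)) (λ e → ∑ (boundedLists N m) (λ r → f (e ∷ r)))
∑-boundedLists-suc N m f =
  trans (∑-concatMap (λ e → map (e ∷_) (boundedLists N m)) (upTo (suc N)) f)
        (∑-cong (upTo (suc N)) (λ e → ∑-map (e ∷_) (boundedLists N m) f))

∑-boundedLists-widen : (N m : ℕ) (f : List ℕ → ℤ) → (∀ c → Any (N <_) c → f c ≡ + 0) →
  ∑ (boundedLists (suc N) m) f ≡ ∑ (boundedLists N m) f
∑-boundedLists-widen N zero f _ = refl
∑-boundedLists-widen N (suc m) f vanish = begin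
  ∑ (boundedLists (suc N) (suc m)) f                  ≡⟨ ∑-boundedLists-suc (suc N) m f ⟩
  ∑ (upTo (suc (suc N))) extend                       ≡⟨ ∑-upTo-suc (suc N) extend ⟩
  ∑ (upTo (suc N)) extend ℤ.+ extend (suc N)          ≡⟨ cong (λ z → ∑ (upTo (suc N)) extend ℤ.+ z) top-vanishes ⟩
  ∑ (upTo (suc N)) extend ℤ.+ + 0                     ≡⟨ ℤ.+-identityʳ _ ⟩
  ∑ (upTo (suc N)) extend                             ≡⟨ ∑-cong (upTo (suc N)) shrink ⟩
  ∑ (upTo (suc N)) (λ e → ∑ (boundedLists N m) (λ r → f (e ∷ r))) ≡⟨ sym (∑-boundedLists-suc N m f) ⟩
  ∑ (boundedLists N (suc m)) f                        ∎
  where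
  extend : ℕ → ℤ
  extend e = ∑ (boundedLists (suc N) m) (λ r → f (e ∷ r))
  top-vanishes : extend (suc N) ≡ + 0
  top-vanishes = ∑-zero (boundedLists (suc N) m) (All.tabulate (λ {r} _ → vanish (suc N ∷ r) (here (ℕ.n<1+n N))))
  shrink : ∀ e → extend e ≡ ∑ (boundedLists N m) (λ r → f (e ∷ r))
  shrink e = ∑-boundedLists-widen N m (λ r → f (e ∷ r)) (λ r any → vanish (e ∷ r) (there any))

∑-boundedLists-bound-irrelevant : (m : ℕ) {B N : ℕ} (f : List ℕ → ℤ) → (∀ c → Any (B <_) c → f c ≡ + 0) →
  B ≤′ N → ∑ (boundedLists N m) f ≡ ∑ (boundedLists B m) f
∑-boundedLists-bound-irrelevant m f vanish ≤′-refl = refl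
∑-boundedLists-bound-irrelevant m {B} f vanish (≤′-step {N} B≤′N) =
  trans (∑-boundedLists-widen N m f (λ c any → vanish c (Any.map (ℕ.≤-<-trans (ℕ.≤′⇒≤ B≤′N)) any)))
        (∑-boundedLists-bound-irrelevant m f vanish B≤′N)

columnWeight : ℕ → ℕ → List ℕ → ℤ
columnWeight R m c = if (length c ≡ᵇ m) ∧ columnOK R c then prodℤ (map (λ e → - (+ e)) c) else + 0

columnSum : ℕ → ℕ → ℕ → ℤ
columnSum N R m = ∑ (boundedLists N m) (columnWeight R m)

boundedFrom⇒All≤ : (R k : ℕ) (c : List ℕ) → T (boundedFrom R k c) → All (_≤ k + length c + R) c
boundedFrom⇒All≤ R k [] _ = []
boundedFrom⇒All≤ R k (e ∷ r) ok with to T-∧ ok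
... | e≤k+R , r-ok =
  ≤-trans (≤ᵇ⇒≤ e (k + R) e≤k+R) (ℕ.+-monoˡ-≤ R (m≤m+n k (suc (length r))))
  ∷ subst (λ b → All (_≤ b + R) r) (sym (+-suc k (length r))) (boundedFrom⇒All≤ R (suc k) r r-ok)

columnWeight-vanishes : (R m : ℕ) (c : List ℕ) → Any (m + R <_) c → columnWeight R m c ≡ + 0
columnWeight-vanishes R m c large with (length c ≡ᵇ m) ∧ columnOK R c in ok
... | false = refl
... | true with to T-∧ (subst T (sym ok) _)
...   | length≡m , column-ok =
  ⊥-elim (All¬⇒¬Any (All.map (λ e≤m+R m+R<e → <⇒≱ m+R<e e≤m+R) entries≤) large)
  where
  entries≤ : All (_≤ m + R) c
  entries≤ = subst (λ l → All (_≤ l + R) c) (≡ᵇ⇒≡ (length c) m length≡m)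
                   (boundedFrom⇒All≤ R 0 c (proj₂ (to T-∧ column-ok)))

columnSum-bound-irrelevant : (R m : ℕ) {N N′ : ℕ} → m + R ≤ N → m + R ≤ N′ → columnSum N R m ≡ columnSum N′ R m
columnSum-bound-irrelevant R m m+R≤N m+R≤N′ =
  trans (irrelevant m+R≤N) (sym (irrelevant m+R≤N′))
  where
  irrelevant : ∀ {N} → m + R ≤ N → columnSum N R m ≡ columnSum (m + R) R m
  irrelevant le = ∑-boundedLists-bound-irrelevant m (columnWeight R m) (columnWeight-vanishes R m) (≤⇒≤′ le)

tableauWeight : List ℕ → List (List ℕ) → ℤ
tableauWeight ms F = if isTableau ms F then weight F else + 0

tableauSum : ℕ → List ℕ → ℤ
tableauSum N ms = ∑ (boundedFillings N ms) (tableauWeight ms)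

bracket≡tableauSum : (ms : List ℕ) → bracket ms ≡ tableauSum (sum ms) ms
bracket≡tableauSum ms = ∑-filterᵇ (isTableau ms) weight (boundedFillings (sum ms) ms)

∑-boundedFillings-cons : (N m : ℕ) (ms : List ℕ) (f : List (List ℕ) → ℤ) →
  ∑ (boundedFillings N (m ∷ ms)) f ≡ ∑ (boundedLists N m) (λ c → ∑ (boundedFillings N ms) (λ F → f (c ∷ F)))
∑-boundedFillings-cons N m ms f =
  trans (∑-concatMap (λ c → map (c ∷_) (boundedFillings N ms)) (boundedLists N m) f)
        (∑-cong (boundedLists N m) (λ c → ∑-map (c ∷_) (boundedFillings N ms) f))

if-∧-* : (a b : Bool) (x y : ℤ) →
  (if a ∧ b then x ℤ.* y else + 0) ≡ (if a then x else + 0) ℤ.* (if b then y else + 0)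
if-∧-* true  true  x y = refl
if-∧-* true  false x y = sym (*-zeroʳ x)
if-∧-* false b     x y = sym (*-zeroˡ (if b then y else + 0))

tableauWeight-cons : (m b : ℕ) (r c : List ℕ) (F : List (List ℕ)) →
  tableauWeight (m ∷ b ∷ r) (c ∷ F) ≡ columnWeight (sum (b ∷ r)) m c ℤ.* tableauWeight (b ∷ r) F
tableauWeight-cons m b r c F =
  trans (cong (λ t → if t then weight (c ∷ F) else + 0) (sym (∧-assoc (length c ≡ᵇ m) (columnOK R c) _)))
        (split F)
  where
  R = sum (b ∷ r)
  guard = (length c ≡ᵇ m) ∧ columnOK R c
  split : ∀ F → (if guard ∧ isTableau (b ∷ r) F then weight (c ∷ F) else + 0)
                ≡ columnWeight R m c ℤ.* tableauWeight (b ∷ r) F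
  split [] = trans (cong (λ t → if t then + 1 else + 0) (∧-zeroʳ guard)) (sym (*-zeroʳ (columnWeight R m c)))
  split (c′ ∷ F) = if-∧-* guard (isTableau (b ∷ r) (c′ ∷ F)) _ _

tableauSum-cons : (N m b : ℕ) (r : List ℕ) →
  tableauSum N (m ∷ b ∷ r) ≡ columnSum N (sum (b ∷ r)) m ℤ.* tableauSum N (b ∷ r)
tableauSum-cons N m b r = begin
  tableauSum N (m ∷ b ∷ r)
    ≡⟨ ∑-boundedFillings-cons N m (b ∷ r) (tableauWeight (m ∷ b ∷ r)) ⟩
  ∑ (boundedLists N m) (λ c → ∑ rest (λ F → tableauWeight (m ∷ b ∷ r) (c ∷ F)))
    ≡⟨ ∑-cong (boundedLists N m) (λ c → ∑-cong rest (tableauWeight-cons m b r c)) ⟩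
  ∑ (boundedLists N m) (λ c → ∑ rest (λ F → columnWeight (sum (b ∷ r)) m c ℤ.* tableauWeight (b ∷ r) F))
    ≡⟨ ∑-cong (boundedLists N m) (λ c → ∑-*ˡ rest (columnWeight (sum (b ∷ r)) m c) (tableauWeight (b ∷ r))) ⟩
  ∑ (boundedLists N m) (λ c → columnWeight (sum (b ∷ r)) m c ℤ.* tableauSum N (b ∷ r))
    ≡⟨ ∑-*ʳ (boundedLists N m) (tableauSum N (b ∷ r)) (columnWeight (sum (b ∷ r)) m) ⟩
  columnSum N (sum (b ∷ r)) m ℤ.* tableauSum N (b ∷ r) ∎
  where
  rest = boundedFillings N (b ∷ r)

startsAtLeast : ℕ → List ℕ → Bool
startsAtLeast k [] = true
startsAtLeast k (e ∷ _) = k ≤ᵇ e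

isRunFrom : ℕ → List ℕ → Bool
isRunFrom k [] = true
isRunFrom k (e ∷ r) = (e ≡ᵇ k) ∧ isRunFrom (suc k) r

strictlyIncreasing-cons : (e : ℕ) (r : List ℕ) →
  strictlyIncreasing (e ∷ r) ≡ startsAtLeast (suc e) r ∧ strictlyIncreasing r
strictlyIncreasing-cons e [] = refl
strictlyIncreasing-cons e (_ ∷ _) = refl

startsAtLeast∧columnOK₀≡isRunFrom : (k : ℕ) (c : List ℕ) →
  startsAtLeast k c ∧ (strictlyIncreasing c ∧ boundedFrom 0 k c) ≡ isRunFrom k c
startsAtLeast∧columnOK₀≡isRunFrom k [] = refl
startsAtLeast∧columnOK₀≡isRunFrom k (e ∷ r) with <-cmp e k
... | tri< e<k _ _
  rewrite ¬T⇒≡false {k ≤ᵇ e} (λ t → <⇒≱ e<k (≤ᵇ⇒≤ k e t))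
        | ¬T⇒≡false {e ≡ᵇ k} (λ t → <⇒≢ e<k (≡ᵇ⇒≡ e k t)) = refl
... | tri> _ _ k<e
  rewrite ¬T⇒≡false {e ≤ᵇ k + 0} (λ t → <⇒≱ k<e (subst (e ≤_) (ℕ.+-identityʳ k) (≤ᵇ⇒≤ e (k + 0) t)))
        | ¬T⇒≡false {e ≡ᵇ k} (λ t → >⇒≢ k<e (≡ᵇ⇒≡ e k t))
        | ∧-zeroʳ (strictlyIncreasing (e ∷ r)) = ∧-zeroʳ (k ≤ᵇ e)
... | tri≈ _ refl _
  rewrite T⇒≡true (≤⇒≤ᵇ (≤-refl {e})) | T⇒≡true (≤⇒≤ᵇ (m≤m+n e 0)) | T⇒≡true (≡⇒≡ᵇ e e refl)
        | strictlyIncreasing-cons e r =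
  trans (∧-assoc (startsAtLeast (suc e) r) _ _) (startsAtLeast∧columnOK₀≡isRunFrom (suc e) r)

columnOK₀≡isRunFrom : (c : List ℕ) → columnOK 0 c ≡ isRunFrom 0 c
columnOK₀≡isRunFrom [] = refl
columnOK₀≡isRunFrom c@(_ ∷ _) = startsAtLeast∧columnOK₀≡isRunFrom 0 c

runIndicator : ℕ → ℕ → List ℕ → ℤ
runIndicator m k c = if (length c ≡ᵇ m) ∧ isRunFrom k c then + 1 else + 0

runIndicator-cons : (m k e : ℕ) (r : List ℕ) →
  runIndicator (suc m) k (e ∷ r) ≡ (if e ≡ᵇ k then runIndicator m (suc k) r else + 0)
runIndicator-cons m k e r with e ≡ᵇ k | length r ≡ᵇ m
... | true  | _     = refl
... | false | true  = refl
... | false | false = refl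

∑-runIndicator : (N m k : ℕ) → k + m ≤ suc N → ∑ (boundedLists N m) (runIndicator m k) ≡ + 1
∑-runIndicator N zero k _ = refl
∑-runIndicator N (suc m) k k+m≤1+N = begin
  ∑ (boundedLists N (suc m)) (runIndicator (suc m) k)
    ≡⟨ ∑-boundedLists-suc N m (runIndicator (suc m) k) ⟩
  ∑ (upTo (suc N)) (λ e → ∑ (boundedLists N m) (λ r → runIndicator (suc m) k (e ∷ r)))
    ≡⟨ ∑-upTo-single (suc N) k _ k<1+N other-heads-vanish ⟩
  ∑ (boundedLists N m) (λ r → runIndicator (suc m) k (k ∷ r))
    ≡⟨ ∑-cong (boundedLists N m) head-k ⟩
  ∑ (boundedLists N m) (runIndicator m (suc k))
    ≡⟨ ∑-runIndicator N m (suc k) 1+k+m≤1+N ⟩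
  + 1 ∎
  where
  1+k+m≤1+N : suc k + m ≤ suc N
  1+k+m≤1+N = subst (_≤ suc N) (+-suc k m) k+m≤1+N
  k<1+N : k < suc N
  k<1+N = ≤-trans (s≤s (m≤m+n k m)) 1+k+m≤1+N
  head-k : ∀ r → runIndicator (suc m) k (k ∷ r) ≡ runIndicator m (suc k) r
  head-k r = trans (runIndicator-cons m k k r)
                   (cong (λ t → if t then runIndicator m (suc k) r else + 0) (T⇒≡true (≡⇒≡ᵇ k k refl)))
  head-other : ∀ e r → e ≢ k → runIndicator (suc m) k (e ∷ r) ≡ + 0
  head-other e r e≢k = trans (runIndicator-cons m k e r)
                             (cong (λ t → if t then runIndicator m (suc k) r else + 0) (¬T⇒≡false (e≢k ∘ ≡ᵇ⇒≡ e k)))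
  other-heads-vanish : ∀ e → e ≢ k → ∑ (boundedLists N m) (λ r → runIndicator (suc m) k (e ∷ r)) ≡ + 0
  other-heads-vanish e e≢k = ∑-zero (boundedLists N m) (All.tabulate λ {r} _ → head-other e r e≢k)

tableauSum-single : (N m : ℕ) → m ≤ N → tableauSum N (m ∷ []) ≡ + 1
tableauSum-single N m m≤N = begin
  tableauSum N (m ∷ [])
    ≡⟨ ∑-boundedFillings-cons N m [] (tableauWeight (m ∷ [])) ⟩
  ∑ (boundedLists N m) (λ c → tableauWeight (m ∷ []) (c ∷ []) ℤ.+ + 0)
    ≡⟨ ∑-cong (boundedLists N m) last-column-is-run ⟩
  ∑ (boundedLists N m) (runIndicator m 0)
    ≡⟨ ∑-runIndicator N m 0 (m≤n⇒m≤1+n m≤N) ⟩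
  + 1 ∎
  where
  last-column-is-run : ∀ c → tableauWeight (m ∷ []) (c ∷ []) ℤ.+ + 0 ≡ runIndicator m 0 c
  last-column-is-run c =
    trans (ℤ.+-identityʳ _) (cong (λ t → if (length c ≡ᵇ m) ∧ t then + 1 else + 0)
                                     (trans (∧-identityʳ (columnOK 0 c)) (columnOK₀≡isRunFrom c)))

bracket-twoColumns : (m s : ℕ) → bracket (m ∷ s ∷ []) ≡ columnSum (m + (s + 0)) s m
bracket-twoColumns m s = begin
  bracket (m ∷ s ∷ [])
    ≡⟨ bracket≡tableauSum (m ∷ s ∷ []) ⟩
  tableauSum N (m ∷ s ∷ [])
    ≡⟨ tableauSum-cons N m s [] ⟩
  columnSum N (s + 0) m ℤ.* tableauSum N (s ∷ [])
    ≡⟨ cong₂ (λ R t → columnSum N R m ℤ.* t) (ℕ.+-identityʳ s) last-column ⟩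
  columnSum N s m ℤ.* + 1
    ≡⟨ *-identityʳ (columnSum N s m) ⟩
  columnSum N s m ∎
  where
  N = m + (s + 0)
  last-column : tableauSum N (s ∷ []) ≡ + 1
  last-column = tableauSum-single N s (≤-trans (m≤m+n s 0) (m≤n+m (s + 0) m))

tableauSum≡rhsProduct : (m : ℕ) (ms : List ℕ) (N : ℕ) → sum (m ∷ ms) ≤ N →
  tableauSum N (m ∷ ms) ≡ rhsProduct (m ∷ ms)
tableauSum≡rhsProduct m [] N m+0≤N = tableauSum-single N m (≤-trans (m≤m+n m 0) m+0≤N)
tableauSum≡rhsProduct m (b ∷ r) N m+s≤N = begin
  tableauSum N (m ∷ b ∷ r)                     ≡⟨ tableauSum-cons N m b r ⟩
  columnSum N s m ℤ.* tableauSum N (b ∷ r)     ≡⟨ cong₂ ℤ._*_ first-column rest ⟩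
  bracket (m ∷ s ∷ []) ℤ.* rhsProduct (b ∷ r)  ∎
  where
  s = sum (b ∷ r)
  first-column : columnSum N s m ≡ bracket (m ∷ s ∷ [])
  first-column = trans (columnSum-bound-irrelevant s m m+s≤N (ℕ.+-monoʳ-≤ m (m≤m+n s 0)))
                       (sym (bracket-twoColumns m s))
  rest : tableauSum N (b ∷ r) ≡ rhsProduct (b ∷ r)
  rest = tableauSum≡rhsProduct b r N (≤-trans (m≤n+m s m) m+s≤N)

mainTheorem6 : (ms : List ℕ) → 2 ≤ length ms → bracket ms ≡ rhsProduct ms
mainTheorem6 (m ∷ ms) _ = trans (bracket≡tableauSum (m ∷ ms)) (tableauSum≡rhsProduct m ms (sum (m ∷ ms)) ≤-refl)
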